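{- Let $2\le k<\omega$ and write $\mathbb A$ for $\mathbb A_k$. For all ordinals $\xi<\zeta<\varepsilon_0$, the number $\mathbb A(\zeta)$ does not lie in the open interval $\big(\mathbb A(\xi),\mathbb A(\xi+1)\big)$.
   Context: Ordinals: $\varepsilon_0$ is the least ordinal $\varepsilon$ with $\omega^\varepsilon=\varepsilon$. Every $0<\xi<\varepsilon_0$ has a unique $\omega$-normal form $\xi=\omega^{\alpha}b+\gamma$ with $\alpha<\xi$, $b$ a positive natural number, $\gamma<\omega^\alpha$. $\mathrm{coeffs}(0)=\{0\}$, $\mathrm{coeffs}(\omega^\alpha b+\gamma)=\mathrm{coeffs}(\alpha)\cup\mathrm{coeffs}(\gamma)\cup\{b\}$, $\mathrm{mc}(\xi)=\max\mathrm{coeffs}(\xi)$. Fundamental sequences: $0[n]=1[n]=0$; $(\omega^\alpha b+\gamma)[n]=\omega^\alpha b+\gamma[n]$ if $\gamma>0$; $\omega^{\alpha+1}[n]=\omega^\alpha n$; $(\omega^\alpha(b+1))[n]=\omega^\alpha b+(\omega^\alpha)[n]$ if $b>0$; $(\omega^\alpha)[n]=\omega^{\alpha[n]}$ if $\alpha$ is a limit. For $2\le k<\omega$, $\mathbb A_k:\varepsilon_0\to\mathbb N$: $\mathbb A_k(\xi)=\xi+1$ if $\xi<\omega$; if $\xi\ge\omega$, write $\xi=\alpha+b$ with $\alpha$ a limit, $b<\omega$; $\mathbb A_k^{(0)}(\xi)=\mathbb A_k(\xi-1)$ if $b>0$, $=\mathrm{mc}(\xi)$ if $b=0$; $\mathbb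 A_k^{(i+1)}(\xi)=\mathbb A_k(\alpha[\mathbb A_k^{(i)}(\xi)])$; $\mathbb A_k(\xi)=\mathbb A_k^{(k)}(\xi)$. -}

module Defs where

open import Data.Nat using (ℕ; zero; suc; _≤_; _<_; _⊔_)
open import Data.Product using (_×_; _,_; proj₁; proj₂)
open import Relation.Binary.PropositionalEquality using (_≡_)
open import Relation.Nullary using (¬_)

-- Ordinals below ε₀ as Cantor (ω-)normal-form terms.
-- ω^ a · b + c  denotes  ω^a · b + c.

infix 30 ω^_·_+_
infix 4 _<ₜ_

data Tm : Set where
  𝟎      : Tm
  ω^_·_+_ : Tm → ℕ → Tm → Tm

-- Ordinal order on terms (lexicographic; correct on normal forms).
data _<ₜ_ : Tm → Tm → Set where
  z<ω : ∀ {a b c} → 𝟎 <ₜ ω^ a · b + c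
  exp< : ∀ {a b c a' b' c'} → a <ₜ a' → ω^ a · b + c <ₜ ω^ a' · b' + c'
  coef< : ∀ {a b c b' c'} → b < b' → ω^ a · b + c <ₜ ω^ a · b' + c'
  tail< : ∀ {a b c c'} → c <ₜ c' → ω^ a · b + c <ₜ ω^ a · b + c'

data NF : Tm → Set where
  nf𝟎 : NF 𝟎
  nfω : ∀ {a b c} → NF a → 1 ≤ b → NF c → c <ₜ ω^ a · 1 + 𝟎 → NF (ω^ a · b + c)

-- Decomposition ξ = α + b with α zero or a limit, b < ω.

split : Tm → Tm × ℕ
split 𝟎 = 𝟎 , 0
split (ω^ 𝟎 · b + c) = 𝟎 , b
split (ω^ (ω^ a · b' + c') · b + c) =
  (ω^ (ω^ a · b' + c') · b + proj₁ (split c)) , proj₂ (split c)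

limPart : Tm → Tm
limPart ξ = proj₁ (split ξ)

finPart : Tm → ℕ
finPart ξ = proj₂ (split ξ)

-- α + n for α zero or a limit (in normal form).
appendFin : Tm → ℕ → Tm
appendFin t zero = t
appendFin 𝟎 (suc n) = ω^ 𝟎 · suc n + 𝟎
appendFin (ω^ a · b + c) (suc n) = ω^ a · b + appendFin c (suc n)

succₜ : Tm → Tm
succₜ ξ = appendFin (limPart ξ) (suc (finPart ξ))

ωmul : Tm → ℕ → Tm
ωmul a zero = 𝟎
ωmul a (suc n) = ω^ a · suc n + 𝟎

mutual
  fs : Tm → ℕ → Tm
  fs 𝟎 n = 𝟎
  fs (ω^ a · b + (ω^ a' · b' + c')) n = ω^ a · b + fs (ω^ a' · b' + c') n
  fs (ω^ a · zero + 𝟎) n = 𝟎      -- not a normal form; irrelevant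
  fs (ω^ a · suc zero + 𝟎) n = ωfs a n
  fs (ω^ a · suc (suc b) + 𝟎) n = ω^ a · suc b + ωfs a n

  -- (ω^a)[n]
  ωfs : Tm → ℕ → Tm
  ωfs 𝟎 n = 𝟎
  ωfs (ω^ a · b + c) n = ωfsAux (ω^ a · b + c) (split (ω^ a · b + c)) n

  ωfsAux : Tm → Tm × ℕ → ℕ → Tm
  ωfsAux a (α , suc m) n = ωmul (appendFin α m) n      -- a successor: ω^{a-1}·n
  ωfsAux (ω^ a · b + c) (α , zero) n = ω^ (fs (ω^ a · b + c) n) · 1 + 𝟎
  ωfsAux 𝟎 (α , zero) n = 𝟎

mc : Tm → ℕ
mc 𝟎 = 0
mc (ω^ a · b + c) = mc a ⊔ (mc c ⊔ b)

-- The function 𝔸_k, given by its graph  AG k ξ m  ("𝔸_k(ξ) = m").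

mutual
  -- Iter k α i m r : starting from 𝔸^(0) = m, after i steps
  -- 𝔸^(j+1) = 𝔸_k(α[𝔸^(j)]), the value is r.
  data Iter (k : ℕ) (α : Tm) : ℕ → ℕ → ℕ → Set where
    done : ∀ {m} → Iter k α 0 m m
    step : ∀ {i m m' r} → AG k (fs α m) m' → Iter k α i m' r → Iter k α (suc i) m r

  data AG (k : ℕ) : Tm → ℕ → Set where
    finite : ∀ {ξ} → limPart ξ ≡ 𝟎 → AG k ξ (suc (finPart ξ))
    succCase : ∀ {ξ b m₀ r} → ¬ (limPart ξ ≡ 𝟎) → finPart ξ ≡ suc b →
               AG k (appendFin (limPart ξ) b) m₀ →
               Iter k (limPart ξ) k m₀ r → AG k ξ r
    limCase : ∀ {ξ r} → ¬ (limPart ξ ≡ 𝟎) → finPart ξ ≡ 0 →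
              Iter k (limPart ξ) k (mc ξ) r → AG k ξ r

-- 𝔸(ξ) exceeds the maximal coefficient of ξ, so every iteration step 𝔸(α[m]) > m increases the
-- value. For a limit α, the Bachmann property says that every η with α[m] ≤ η < α reaches α[m]
-- by repeatedly taking [1]. Consequently 𝔸 can only decrease along [1]-steps: at a limit η the
-- first iteration step evaluates 𝔸 at η[mc(η)], which reaches η[1] because mc(η) ≥ 1.
--
-- The theorem follows from: if η < ζ and 𝔸(η) < 𝔸(ζ), then 𝔸(η+1) ≤ 𝔸(ζ), by induction on the
-- computation of 𝔸(ζ). Let α be the limit part of ζ. If η ≥ α, then ζ reaches η+1 by [1]-steps.
-- If η < α, look at the last iteration step 𝔸(ζ) = 𝔸(α[m]): when η < α[m] use induction, and
-- when η ≥ α[m] the Bachmann property gives 𝔸(ζ) ≤ 𝔸(η), which is excluded.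

module Submission where

open import Defs
open import Data.Nat using (ℕ; zero; suc; _≤_; _<_; _⊔_; z≤n; s≤s)
open import Data.Nat.Properties
open import Data.Product using (_×_; _,_; ∃-syntax)
open import Data.Sum using (_⊎_; inj₁; inj₂)
open import Data.Empty using (⊥-elim)
open import Relation.Nullary using (¬_)
open import Relation.Binary.PropositionalEquality
open import Relation.Binary.Definitions using (Trichotomous; Tri; tri<; tri≈; tri>)
open import Relation.Binary.Construct.Closure.ReflexiveTransitive using (Star; ε; _◅_; _◅◅_; gmap)

infix 30 ω^_

ω^_ : Tm → Tm
ω^ a = ω^ a · 1 + 𝟎

<ₜ-trans : ∀ {x y z} → x <ₜ y → y <ₜ z → x <ₜ z
<ₜ-trans z<ω (exp< q) = z<ω
<ₜ-trans z<ω (coef< q) = z<ω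
<ₜ-trans z<ω (tail< q) = z<ω
<ₜ-trans (exp< p) (exp< q) = exp< (<ₜ-trans p q)
<ₜ-trans (exp< p) (coef< q) = exp< p
<ₜ-trans (exp< p) (tail< q) = exp< p
<ₜ-trans (coef< p) (exp< q) = exp< q
<ₜ-trans (coef< p) (coef< q) = coef< (<-trans p q)
<ₜ-trans (coef< p) (tail< q) = coef< p
<ₜ-trans (tail< p) (exp< q) = exp< q
<ₜ-trans (tail< p) (coef< q) = coef< q
<ₜ-trans (tail< p) (tail< q) = tail< (<ₜ-trans p q)

<ₜ-irrefl : ∀ {x} → ¬ x <ₜ x
<ₜ-irrefl (exp< p) = <ₜ-irrefl p
<ₜ-irrefl (coef< p) = <-irrefl refl p
<ₜ-irrefl (tail< p) = <ₜ-irrefl p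

<ₜ-asym : ∀ {x y} → x <ₜ y → ¬ y <ₜ x
<ₜ-asym p q = <ₜ-irrefl (<ₜ-trans p q)

≮ₜ𝟎 : ∀ {x} → ¬ x <ₜ 𝟎
≮ₜ𝟎 ()

private
  tri-< : ∀ {x y} → x <ₜ y → Tri (x <ₜ y) (x ≡ y) (y <ₜ x)
  tri-< p = tri< p (λ { refl → <ₜ-irrefl p }) (<ₜ-asym p)

  tri-> : ∀ {x y} → y <ₜ x → Tri (x <ₜ y) (x ≡ y) (y <ₜ x)
  tri-> p = tri> (<ₜ-asym p) (λ { refl → <ₜ-irrefl p }) p

<ₜ-cmp : Trichotomous _≡_ _<ₜ_
<ₜ-cmp 𝟎 𝟎 = tri≈ ≮ₜ𝟎 refl ≮ₜ𝟎
<ₜ-cmp 𝟎 (ω^ _ · _ + _) = tri-< z<ω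
<ₜ-cmp (ω^ _ · _ + _) 𝟎 = tri-> z<ω
<ₜ-cmp (ω^ a · b + c) (ω^ a' · b' + c') with <ₜ-cmp a a' | <-cmp b b' | <ₜ-cmp c c'
... | tri< p _ _ | _ | _ = tri-< (exp< p)
... | tri> _ _ p | _ | _ = tri-> (exp< p)
... | tri≈ _ refl _ | tri< p _ _ | _ = tri-< (coef< p)
... | tri≈ _ refl _ | tri> _ _ p | _ = tri-> (coef< p)
... | tri≈ _ refl _ | tri≈ _ refl _ | tri< p _ _ = tri-< (tail< p)
... | tri≈ _ refl _ | tri≈ _ refl _ | tri> _ _ p = tri-> (tail< p)
... | tri≈ _ refl _ | tri≈ _ refl _ | tri≈ _ refl _ = tri≈ <ₜ-irrefl refl <ₜ-irrefl

infix 4 _≤ₜ_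

_≤ₜ_ : Tm → Tm → Set
x ≤ₜ y = x <ₜ y ⊎ x ≡ y

≤ₜ-tail : ∀ {a b x y} → x ≤ₜ y → ω^ a · b + x ≤ₜ ω^ a · b + y
≤ₜ-tail (inj₁ x<y) = inj₁ (tail< x<y)
≤ₜ-tail (inj₂ refl) = inj₂ refl

≤ₜ-exp : ∀ {x y} → x ≤ₜ y → ω^ x ≤ₜ ω^ y
≤ₜ-exp (inj₁ x<y) = inj₁ (exp< x<y)
≤ₜ-exp (inj₂ refl) = inj₂ refl

NF-exponent : ∀ {a b c} → NF (ω^ a · b + c) → NF a
NF-exponent (nfω nfa _ _ _) = nfa

NF-tail : ∀ {a b c} → NF (ω^ a · b + c) → NF c
NF-tail (nfω _ _ nfc _) = nfc

NF-<ₜω^𝟎⇒≡𝟎 : ∀ {c} → NF c → c <ₜ ω^ 𝟎 → c ≡ 𝟎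
NF-<ₜω^𝟎⇒≡𝟎 nf𝟎 _ = refl
NF-<ₜω^𝟎⇒≡𝟎 (nfω _ () _ _) (coef< (s≤s z≤n))

data Lim₀ : Tm → Set where
  lim𝟎 : Lim₀ 𝟎
  limω : ∀ {a b' c' b c} → Lim₀ c → Lim₀ (ω^ (ω^ a · b' + c') · b + c)

appendFin-ω : ∀ {a b l} n → appendFin (ω^ a · b + l) n ≡ ω^ a · b + appendFin l n
appendFin-ω zero = refl
appendFin-ω (suc n) = refl

appendFin-suc≢𝟎 : ∀ l j → appendFin l (suc j) ≢ 𝟎
appendFin-suc≢𝟎 𝟎 j ()
appendFin-suc≢𝟎 (ω^ a · b + c) j ()

appendFin-<ₜ-suc : ∀ {l} → Lim₀ l → ∀ j → appendFin l j <ₜ appendFin l (suc j)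
appendFin-<ₜ-suc lim𝟎 zero = z<ω
appendFin-<ₜ-suc lim𝟎 (suc j) = coef< (n<1+n (suc j))
appendFin-<ₜ-suc (limω l) zero = tail< (appendFin-<ₜ-suc l zero)
appendFin-<ₜ-suc (limω l) (suc j) = tail< (appendFin-<ₜ-suc l (suc j))

Lim₀-limPart : ∀ t → Lim₀ (limPart t)
Lim₀-limPart 𝟎 = lim𝟎
Lim₀-limPart (ω^ 𝟎 · b + c) = lim𝟎
Lim₀-limPart (ω^ (ω^ a · b' + c') · b + c) = limω (Lim₀-limPart c)

split-appendFin : ∀ {l} → Lim₀ l → ∀ j → split (appendFin l j) ≡ (l , j)
split-appendFin lim𝟎 zero = refl
split-appendFin lim𝟎 (suc j) = refl
split-appendFin (limω l) zero rewrite split-appendFin l zero = refl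
split-appendFin (limω l) (suc j) rewrite split-appendFin l (suc j) = refl

succₜ-appendFin : ∀ {l} → Lim₀ l → ∀ j → succₜ (appendFin l j) ≡ appendFin l (suc j)
succₜ-appendFin l j rewrite split-appendFin l j = refl

appendFin-split : ∀ {t} → NF t → appendFin (limPart t) (finPart t) ≡ t
appendFin-split nf𝟎 = refl
appendFin-split {ω^ 𝟎 · b + c} (nfω _ (s≤s _) nfc c<ω^𝟎) rewrite NF-<ₜω^𝟎⇒≡𝟎 nfc c<ω^𝟎 = refl
appendFin-split {ω^ (ω^ a · b' + c') · b + c} (nfω _ _ nfc _) =
  trans (appendFin-ω (finPart c)) (cong (ω^ (ω^ a · b' + c') · b +_) (appendFin-split nfc))

appendFin-limPart : ∀ {t n} → NF t → finPart t ≡ n → appendFin (limPart t) n ≡ t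
appendFin-limPart nf refl = appendFin-split nf

NF-limPart : ∀ {t} → NF t → NF (limPart t)
NF-limPart nf𝟎 = nf𝟎
NF-limPart {ω^ 𝟎 · b + c} _ = nf𝟎
NF-limPart {ω^ (ω^ a · b' + c') · b + c} (nfω nfa 1≤b nfc c<ω^a) =
  nfω nfa 1≤b (NF-limPart nfc) (limPart-<ₜ c<ω^a)
  where
  limPart-<ₜ : ∀ {x} → x <ₜ ω^ (ω^ a · b' + c') → limPart x <ₜ ω^ (ω^ a · b' + c')
  limPart-<ₜ {𝟎} _ = z<ω
  limPart-<ₜ {ω^ 𝟎 · _ + _} _ = z<ω
  limPart-<ₜ {ω^ (ω^ _ · _ + _) · _ + _} (exp< p) = exp< p
  limPart-<ₜ {ω^ (ω^ _ · _ + _) · _ + _} (coef< p) = coef< p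

NF-appendFin : ∀ {l} → NF l → Lim₀ l → ∀ j → NF (appendFin l j)
NF-appendFin nfl _ zero = nfl
NF-appendFin _ lim𝟎 (suc j) = nfω nf𝟎 (s≤s z≤n) nf𝟎 z<ω
NF-appendFin {ω^ (ω^ a · b' + c') · b + c} (nfω nfa 1≤b nfc c<ω^a) (limω l) (suc j) =
  nfω nfa 1≤b (NF-appendFin nfc l (suc j)) (appendFin-<ₜ l c<ω^a)
  where
  appendFin-<ₜ : ∀ {x} → Lim₀ x → x <ₜ ω^ (ω^ a · b' + c') →
                 appendFin x (suc j) <ₜ ω^ (ω^ a · b' + c')
  appendFin-<ₜ lim𝟎 _ = exp< z<ω
  appendFin-<ₜ (limω _) (exp< p) = exp< p
  appendFin-<ₜ (limω _) (coef< p) = coef< p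

fs-tail : ∀ {a b t} n → t ≢ 𝟎 → fs (ω^ a · b + t) n ≡ ω^ a · b + fs t n
fs-tail {t = 𝟎} n t≢𝟎 = ⊥-elim (t≢𝟎 refl)
fs-tail {t = ω^ _ · _ + _} n _ = refl

fs-appendFin-suc : ∀ {l} → Lim₀ l → ∀ j → fs (appendFin l (suc j)) 1 ≡ appendFin l j
fs-appendFin-suc lim𝟎 zero = refl
fs-appendFin-suc lim𝟎 (suc j) = refl
fs-appendFin-suc (limω {a} {b'} {c'} {b} {c} l) j = begin
  fs (ω^ E · b + appendFin c (suc j)) 1  ≡⟨ fs-tail 1 (appendFin-suc≢𝟎 c j) ⟩
  ω^ E · b + fs (appendFin c (suc j)) 1  ≡⟨ cong (ω^ E · b +_) (fs-appendFin-suc l j) ⟩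
  ω^ E · b + appendFin c j              ≡⟨ appendFin-ω j ⟨
  appendFin (ω^ E · b + c) j            ∎
  where
  open ≡-Reasoning
  E : Tm
  E = ω^ a · b' + c'

ωmul-<ₜ : ∀ {x y} → x <ₜ y → ∀ n → ωmul x n <ₜ ω^ y
ωmul-<ₜ x<y zero = z<ω
ωmul-<ₜ x<y (suc n) = exp< x<y

NF-ωmul : ∀ {x} → NF x → ∀ n → NF (ωmul x n)
NF-ωmul nfx zero = nf𝟎
NF-ωmul nfx (suc n) = nfω nfx (s≤s z≤n) nf𝟎 z<ω

ωmul-mono : ∀ x {m n} → m ≤ n → ωmul x m ≤ₜ ωmul x n
ωmul-mono x {zero} {zero} _ = inj₂ refl
ωmul-mono x {zero} {suc n} _ = inj₁ z<ω
ωmul-mono x {suc m} {suc n} m≤n with m≤n⇒m<n∨m≡n m≤n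
... | inj₁ m<n = inj₁ (coef< m<n)
... | inj₂ refl = inj₂ refl

data Form : Tm → Set where
  isZero : Form 𝟎
  isSucc : ∀ {l} j → Lim₀ l → NF l → Form (appendFin l (suc j))
  isLimit : ∀ {a b c} → Lim₀ (ω^ a · b + c) → Form (ω^ a · b + c)

form : ∀ {e} → NF e → Form e
form {e} nf with limPart e | finPart e | appendFin-split nf | Lim₀-limPart e | NF-limPart nf
... | l | suc j | refl | L | nfl = isSucc j L nfl
... | 𝟎 | zero | refl | _ | _ = isZero
... | ω^ _ · _ + _ | zero | refl | L | _ = isLimit L

ωfs-appendFin-suc : ∀ {l} → Lim₀ l → ∀ j n → ωfs (appendFin l (suc j)) n ≡ ωmul (appendFin l j) n
ωfs-appendFin-suc lim𝟎 j n = refl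
ωfs-appendFin-suc (limω l) j n rewrite split-appendFin l (suc j) = refl

ωfs-limit : ∀ {a b c} → Lim₀ (ω^ a · b + c) → ∀ n → ωfs (ω^ a · b + c) n ≡ ω^ fs (ω^ a · b + c) n
ωfs-limit (limω l) n rewrite split-appendFin l zero = refl

ωfs-1 : ∀ {e} → NF e → e ≢ 𝟎 → ωfs e 1 ≡ ω^ fs e 1
ωfs-1 nf e≢𝟎 with form nf
... | isZero = ⊥-elim (e≢𝟎 refl)
... | isSucc j L _ = trans (ωfs-appendFin-suc L j 1) (cong ω^_ (sym (fs-appendFin-suc L j)))
... | isLimit L = ωfs-limit L 1

mutual
  fs-<ₜ : ∀ {t} n → NF t → t ≢ 𝟎 → fs t n <ₜ t
  fs-<ₜ {𝟎} n _ t≢𝟎 = ⊥-elim (t≢𝟎 refl)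
  fs-<ₜ {ω^ a · b + (ω^ _ · _ + _)} n (nfω _ _ nfc _) _ = tail< (fs-<ₜ n nfc (λ ()))
  fs-<ₜ {ω^ a · suc zero + 𝟎} n (nfω nfa _ _ _) _ = ωfs-<ₜ n nfa
  fs-<ₜ {ω^ a · suc (suc b) + 𝟎} n _ _ = coef< (n<1+n (suc b))

  ωfs-<ₜ : ∀ {e} n → NF e → ωfs e n <ₜ ω^ e
  ωfs-<ₜ n nf with form nf
  ... | isZero = z<ω
  ... | isSucc j L _ rewrite ωfs-appendFin-suc L j n = ωmul-<ₜ (appendFin-<ₜ-suc L j) n
  ... | isLimit L rewrite ωfs-limit L n = exp< (fs-<ₜ n nf (λ ()))

mutual
  NF-fs : ∀ {t} n → NF t → NF (fs t n)
  NF-fs {𝟎} n _ = nf𝟎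
  NF-fs {ω^ a · b + (ω^ _ · _ + _)} n (nfω nfa 1≤b nfc c<ω^a) =
    nfω nfa 1≤b (NF-fs n nfc) (<ₜ-trans (fs-<ₜ n nfc (λ ())) c<ω^a)
  NF-fs {ω^ a · suc zero + 𝟎} n (nfω nfa _ _ _) = NF-ωfs n nfa
  NF-fs {ω^ a · suc (suc b) + 𝟎} n (nfω nfa _ _ _) =
    nfω nfa (s≤s z≤n) (NF-ωfs n nfa) (ωfs-<ₜ n nfa)

  NF-ωfs : ∀ {e} n → NF e → NF (ωfs e n)
  NF-ωfs n nf with form nf
  ... | isZero = nf𝟎
  ... | isSucc j L nfl rewrite ωfs-appendFin-suc L j n = NF-ωmul (NF-appendFin nfl L j) n
  ... | isLimit L rewrite ωfs-limit L n = nfω (NF-fs n nf) (s≤s z≤n) nf𝟎 z<ω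

mutual
  fs-mono : ∀ {t m n} → NF t → m ≤ n → fs t m ≤ₜ fs t n
  fs-mono {𝟎} _ _ = inj₂ refl
  fs-mono {ω^ a · b + (ω^ _ · _ + _)} (nfω _ _ nfc _) m≤n = ≤ₜ-tail (fs-mono nfc m≤n)
  fs-mono {ω^ a · suc zero + 𝟎} (nfω nfa _ _ _) m≤n = ωfs-mono nfa m≤n
  fs-mono {ω^ a · suc (suc b) + 𝟎} (nfω nfa _ _ _) m≤n = ≤ₜ-tail (ωfs-mono nfa m≤n)

  ωfs-mono : ∀ {e m n} → NF e → m ≤ n → ωfs e m ≤ₜ ωfs e n
  ωfs-mono {m = m} {n} nf m≤n with form nf
  ... | isZero = inj₂ refl
  ... | isSucc {l} j L _ rewrite ωfs-appendFin-suc L j m | ωfs-appendFin-suc L j n =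
    ωmul-mono (appendFin l j) m≤n
  ... | isLimit L rewrite ωfs-limit L m | ωfs-limit L n = ≤ₜ-exp (fs-mono nf m≤n)

mutual
  mc-fs : ∀ {t} → Lim₀ t → NF t → t ≢ 𝟎 → ∀ m → m ≤ mc (fs t m)
  mc-fs {𝟎} _ _ t≢𝟎 m = ⊥-elim (t≢𝟎 refl)
  mc-fs {ω^ a · b + (ω^ _ · _ + _)} (limω L) (nfω _ _ nfc _) _ m =
    m≤n⇒m≤o⊔n (mc a) (m≤n⇒m≤n⊔o b (mc-fs L nfc (λ ()) m))
  mc-fs {ω^ a · suc zero + 𝟎} (limω _) (nfω nfa _ _ _) _ m = mc-ωfs nfa (λ ()) m
  mc-fs {ω^ a · suc (suc b) + 𝟎} (limω _) (nfω nfa _ _ _) _ m =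
    m≤n⇒m≤o⊔n (mc a) (m≤n⇒m≤n⊔o (suc b) (mc-ωfs nfa (λ ()) m))

  mc-ωfs : ∀ {e} → NF e → e ≢ 𝟎 → ∀ m → m ≤ mc (ωfs e m)
  mc-ωfs nf e≢𝟎 m with form nf
  ... | isZero = ⊥-elim (e≢𝟎 refl)
  ... | isSucc {l} j L _ rewrite ωfs-appendFin-suc L j m = mc-ωmul (appendFin l j) m
    where
    mc-ωmul : ∀ x m → m ≤ mc (ωmul x m)
    mc-ωmul x zero = z≤n
    mc-ωmul x (suc m) = m≤n⊔m (mc x) (suc m)
  ... | isLimit L rewrite ωfs-limit L m = m≤n⇒m≤n⊔o 1 (mc-fs L nf (λ ()) m)

mc-appendFin-suc : ∀ l j → mc (appendFin l (suc j)) ≡ mc l ⊔ suc j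
mc-appendFin-suc 𝟎 j = refl
mc-appendFin-suc (ω^ a · b + c) j = begin
  mc a ⊔ (mc (appendFin c (suc j)) ⊔ b) ≡⟨ cong (λ t → mc a ⊔ (t ⊔ b)) (mc-appendFin-suc c j) ⟩
  mc a ⊔ ((mc c ⊔ suc j) ⊔ b)           ≡⟨ cong (mc a ⊔_) (⊔-assoc (mc c) (suc j) b) ⟩
  mc a ⊔ (mc c ⊔ (suc j ⊔ b))           ≡⟨ cong (λ t → mc a ⊔ (mc c ⊔ t)) (⊔-comm (suc j) b) ⟩
  mc a ⊔ (mc c ⊔ (b ⊔ suc j))           ≡⟨ cong (mc a ⊔_) (⊔-assoc (mc c) b (suc j)) ⟨
  mc a ⊔ ((mc c ⊔ b) ⊔ suc j)           ≡⟨ ⊔-assoc (mc a) (mc c ⊔ b) (suc j) ⟨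
  (mc a ⊔ (mc c ⊔ b)) ⊔ suc j           ∎
  where open ≡-Reasoning

mc-appendFin-suc-≤ : ∀ l j → mc (appendFin l (suc j)) ≤ suc (mc (appendFin l j))
mc-appendFin-suc-≤ l zero rewrite mc-appendFin-suc l 0 = ⊔-lub (n≤1+n _) (s≤s z≤n)
mc-appendFin-suc-≤ l (suc j) rewrite mc-appendFin-suc l (suc j) | mc-appendFin-suc l j =
  ⊔-lub (≤-trans (m≤m⊔n (mc l) (suc j)) (n≤1+n _)) (s≤s (m≤n⊔m (mc l) (suc j)))

mc-pos : ∀ {a b c} → NF (ω^ a · b + c) → 1 ≤ mc (ω^ a · b + c)
mc-pos {a} {b} {c} (nfω _ 1≤b _ _) = m≤n⇒m≤o⊔n (mc a) (≤-trans 1≤b (m≤n⊔m (mc c) b))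

infix 4 _⟶₁_ _⟶₁*_

data _⟶₁_ : Tm → Tm → Set where
  step : ∀ {a b c} → ω^ a · b + c ⟶₁ fs (ω^ a · b + c) 1

_⟶₁*_ : Tm → Tm → Set
_⟶₁*_ = Star _⟶₁_

⟶₁*-tail : ∀ {a b t t'} → t ⟶₁* t' → ω^ a · b + t ⟶₁* ω^ a · b + t'
⟶₁*-tail {a} {b} = gmap (ω^ a · b +_) λ { step → step }

⟶₁*-exp : ∀ {x y} → NF x → x ⟶₁* y → ω^ x ⟶₁* ω^ y
⟶₁*-exp _ ε = ε
⟶₁*-exp {x} nf (step ◅ p) = subst (ω^ x ⟶₁_) (ωfs-1 nf (λ ())) step ◅ ⟶₁*-exp (NF-fs 1 nf) p

appendFin-⟶₁ : ∀ {l} → Lim₀ l → ∀ j → appendFin l (suc j) ⟶₁ appendFin l j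
appendFin-⟶₁ {l} L j = subst (appendFin l (suc j) ⟶₁_) (fs-appendFin-suc L j) (appendFin-step L)
  where
  appendFin-step : ∀ {l} → Lim₀ l → appendFin l (suc j) ⟶₁ fs (appendFin l (suc j)) 1
  appendFin-step lim𝟎 = step
  appendFin-step (limω _) = step

appendFin-⟶₁* : ∀ {l i j} → Lim₀ l → j ≤ i → appendFin l i ⟶₁* appendFin l j
appendFin-⟶₁* L j≤i with m≤n⇒m<n∨m≡n j≤i
... | inj₂ refl = ε
... | inj₁ (s≤s j≤i') = appendFin-⟶₁ L _ ◅ appendFin-⟶₁* L j≤i'

mutual
  ⟶₁*-𝟎 : ∀ {t} → NF t → t ⟶₁* 𝟎
  ⟶₁*-𝟎 nf𝟎 = ε
  ⟶₁*-𝟎 (nfω nfa (s≤s _) nfc _) =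
    ⟶₁*-tail (⟶₁*-𝟎 nfc) ◅◅ ω^-⟶₁*-coef nfa z≤n ◅◅ step ◅ ωfs-⟶₁*-𝟎 nfa

  ωfs-⟶₁*-𝟎 : ∀ {e} → NF e → ωfs e 1 ⟶₁* 𝟎
  ωfs-⟶₁*-𝟎 nf𝟎 = ε
  -- (ω^ e)[1] = ω^ (e[1]), so the chain from e to 0 lifts to the exponent; this keeps the
  -- recursion structural.
  ωfs-⟶₁*-𝟎 nf@(nfω _ _ _ _) with ⟶₁*-𝟎 nf
  ... | step ◅ p = subst (_⟶₁* 𝟎) (sym (ωfs-1 nf (λ ()))) (⟶₁*-exp (NF-fs 1 nf) p ◅◅ step ◅ ε)

  ω^-⟶₁*-coef : ∀ {a m n} → NF a → m ≤ n → ω^ a · suc n + 𝟎 ⟶₁* ω^ a · suc m + 𝟎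
  ω^-⟶₁*-coef nfa m≤n with m≤n⇒m<n∨m≡n m≤n
  ... | inj₂ refl = ε
  ... | inj₁ (s≤s m≤n') = step ◅ ⟶₁*-tail (ωfs-⟶₁*-𝟎 nfa) ◅◅ ω^-⟶₁*-coef nfa m≤n'

<ₜ-appendFin-suc : ∀ {l x} → Lim₀ l → NF x → ∀ j → x <ₜ appendFin l (suc j) → x ≤ₜ appendFin l j
<ₜ-appendFin-suc lim𝟎 nf𝟎 zero _ = inj₂ refl
<ₜ-appendFin-suc lim𝟎 nf𝟎 (suc j) _ = inj₁ z<ω
<ₜ-appendFin-suc lim𝟎 (nfω _ () _ _) zero (coef< (s≤s z≤n))
<ₜ-appendFin-suc lim𝟎 (nfω _ _ nfc c<ω^𝟎) (suc j) (coef< (s≤s b≤j))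
  with NF-<ₜω^𝟎⇒≡𝟎 nfc c<ω^𝟎 | m≤n⇒m<n∨m≡n b≤j
... | refl | inj₁ b<j = inj₁ (coef< b<j)
... | refl | inj₂ refl = inj₂ refl
<ₜ-appendFin-suc {ω^ a · b + c} (limω L) nf j x<l+j+1 rewrite appendFin-ω {a} {b} {c} j =
  go nf x<l+j+1
  where
  go : ∀ {x} → NF x → x <ₜ ω^ a · b + appendFin c (suc j) → x ≤ₜ ω^ a · b + appendFin c j
  go nf𝟎 z<ω = inj₁ z<ω
  go _ (exp< p) = inj₁ (exp< p)
  go _ (coef< p) = inj₁ (coef< p)
  go nf (tail< p) = ≤ₜ-tail (<ₜ-appendFin-suc L (NF-tail nf) j p)

appendFin-interval : ∀ {l η} → Lim₀ l → NF η → ¬ η <ₜ l → ∀ j → η <ₜ appendFin l (suc j) →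
                     ∃[ i ] i ≤ j × η ≡ appendFin l i
appendFin-interval L nf η≮l j η<l+j+1 with <ₜ-appendFin-suc L nf j η<l+j+1
... | inj₂ η≡l+j = j , ≤-refl , η≡l+j
appendFin-interval L nf η≮l zero _ | inj₁ η<l = ⊥-elim (η≮l η<l)
appendFin-interval L nf η≮l (suc j) _ | inj₁ η<l+j with appendFin-interval L nf η≮l j η<l+j
... | i , i≤j , η≡l+i = i , m≤n⇒m≤1+n i≤j , η≡l+i

tail-interval : ∀ {a b x y η} → NF η → ω^ a · b + x ≤ₜ η → η <ₜ ω^ a · b + y →
                ∃[ η' ] η ≡ ω^ a · b + η' × NF η' × x ≤ₜ η' × η' <ₜ y
tail-interval nf (inj₂ refl) (exp< q) = ⊥-elim (<ₜ-irrefl q)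
tail-interval nf (inj₂ refl) (coef< q) = ⊥-elim (<-irrefl refl q)
tail-interval nf (inj₂ refl) (tail< q) = _ , refl , NF-tail nf , inj₂ refl , q
tail-interval nf (inj₁ (exp< p)) (exp< q) = ⊥-elim (<ₜ-asym p q)
tail-interval nf (inj₁ (exp< p)) (coef< q) = ⊥-elim (<ₜ-irrefl p)
tail-interval nf (inj₁ (exp< p)) (tail< q) = ⊥-elim (<ₜ-irrefl p)
tail-interval nf (inj₁ (coef< p)) (exp< q) = ⊥-elim (<ₜ-irrefl q)
tail-interval nf (inj₁ (coef< p)) (coef< q) = ⊥-elim (<-asym p q)
tail-interval nf (inj₁ (coef< p)) (tail< q) = ⊥-elim (<-irrefl refl p)
tail-interval nf (inj₁ (tail< p)) (exp< q) = ⊥-elim (<ₜ-irrefl q)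
tail-interval nf (inj₁ (tail< p)) (coef< q) = ⊥-elim (<-irrefl refl q)
tail-interval nf (inj₁ (tail< p)) (tail< q) = _ , refl , NF-tail nf , inj₁ p , q

coef-interval : ∀ {a b x η} → NF η → ω^ a · b + x ≤ₜ η → η <ₜ ω^ a · suc b + 𝟎 →
                ∃[ η' ] η ≡ ω^ a · b + η' × NF η' × x ≤ₜ η' × η' <ₜ ω^ a
coef-interval nf (inj₂ refl) (exp< q) = ⊥-elim (<ₜ-irrefl q)
coef-interval nf@(nfω _ _ nfc c<ω^a) (inj₂ refl) (coef< q) = _ , refl , nfc , inj₂ refl , c<ω^a
coef-interval nf (inj₁ (exp< p)) (exp< q) = ⊥-elim (<ₜ-asym p q)
coef-interval nf (inj₁ (exp< p)) (coef< q) = ⊥-elim (<ₜ-irrefl p)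
coef-interval nf (inj₁ (coef< p)) (exp< q) = ⊥-elim (<ₜ-irrefl q)
coef-interval nf (inj₁ (coef< p)) (coef< (s≤s q)) = ⊥-elim (<-irrefl refl (<-≤-trans p q))
coef-interval nf (inj₁ (tail< p)) (exp< q) = ⊥-elim (<ₜ-irrefl q)
coef-interval (nfω _ _ nfc c<ω^a) (inj₁ (tail< p)) (coef< q) = _ , refl , nfc , inj₁ p , c<ω^a

≤ₜ-exponent : ∀ {e x y z} → (ω^ e) ≤ₜ ω^ x · y + z → e ≤ₜ x
≤ₜ-exponent (inj₂ refl) = inj₂ refl
≤ₜ-exponent (inj₁ (exp< p)) = inj₁ p
≤ₜ-exponent (inj₁ (coef< _)) = inj₂ refl
≤ₜ-exponent (inj₁ (tail< _)) = inj₂ refl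

≤ₜ-coefficient : ∀ {x m y z} → ω^ x · m + 𝟎 ≤ₜ ω^ x · y + z → m ≤ y
≤ₜ-coefficient (inj₂ refl) = ≤-refl
≤ₜ-coefficient (inj₁ (exp< p)) = ⊥-elim (<ₜ-irrefl p)
≤ₜ-coefficient (inj₁ (coef< p)) = <⇒≤ p
≤ₜ-coefficient (inj₁ (tail< _)) = ≤-refl

<ₜ-exponent⇒≱ₜ : ∀ {e s x y z} → x <ₜ e → ¬ ω^ e · s + 𝟎 ≤ₜ ω^ x · y + z
<ₜ-exponent⇒≱ₜ x<e (inj₂ refl) = <ₜ-irrefl x<e
<ₜ-exponent⇒≱ₜ x<e (inj₁ (exp< e<x)) = <ₜ-asym x<e e<x
<ₜ-exponent⇒≱ₜ x<e (inj₁ (coef< _)) = <ₜ-irrefl x<e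
<ₜ-exponent⇒≱ₜ x<e (inj₁ (tail< _)) = <ₜ-irrefl x<e

<ₜω^⇒exponent-<ₜ : ∀ {e x y z} → NF (ω^ x · y + z) → ω^ x · y + z <ₜ ω^ e → x <ₜ e
<ₜω^⇒exponent-<ₜ _ (exp< x<e) = x<e
<ₜω^⇒exponent-<ₜ (nfω _ () _ _) (coef< (s≤s z≤n))

⟶₁*-ω^· : ∀ {x y z m} → NF (ω^ x · y + z) → suc m ≤ y → ω^ x · y + z ⟶₁* ω^ x · suc m + 𝟎
⟶₁*-ω^· (nfω nfx _ nfz _) (s≤s m≤y) = ⟶₁*-tail (⟶₁*-𝟎 nfz) ◅◅ ω^-⟶₁*-coef nfx m≤y

⟶₁*-ωmul : ∀ {l j m η} → Lim₀ l → NF η →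
           ωmul (appendFin l j) m ≤ₜ η → η <ₜ ω^ appendFin l (suc j) → η ⟶₁* ωmul (appendFin l j) m
⟶₁*-ωmul {m = zero} _ nfη _ _ = ⟶₁*-𝟎 nfη
⟶₁*-ωmul {m = suc _} {𝟎} _ _ (inj₁ ()) _
⟶₁*-ωmul {j = j} {suc m} {ω^ x · y + z} L nfη lo up
  with <ₜ-appendFin-suc L (NF-exponent nfη) j (<ₜω^⇒exponent-<ₜ nfη up)
... | inj₁ x<l+j = ⊥-elim (<ₜ-exponent⇒≱ₜ x<l+j lo)
... | inj₂ refl = ⟶₁*-ω^· nfη (≤ₜ-coefficient lo)

⟶₁*-ω^ : ∀ {e f η} → NF η → (ω^ f) ≤ₜ η → η <ₜ ω^ e →
         (∀ {x} → NF x → f ≤ₜ x → x <ₜ e → x ⟶₁* f) → η ⟶₁* ω^ f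
⟶₁*-ω^ {η = 𝟎} _ (inj₁ ()) _ _
⟶₁*-ω^ {η = ω^ x · y + z} nfη@(nfω nfx 1≤y _ _) lo up ⟶₁*-f =
  ⟶₁*-ω^· nfη 1≤y ◅◅ ⟶₁*-exp nfx (⟶₁*-f nfx (≤ₜ-exponent lo) (<ₜω^⇒exponent-<ₜ nfη up))

mutual
  bachmann : ∀ {α} → NF α → Lim₀ α → α ≢ 𝟎 → ∀ m {η} → NF η → fs α m ≤ₜ η → η <ₜ α → η ⟶₁* fs α m
  bachmann {𝟎} _ _ α≢𝟎 = ⊥-elim (α≢𝟎 refl)
  bachmann {ω^ a · b + (ω^ _ · _ + _)} (nfω _ _ nfc _) (limω L) _ m nfη lo up
    with tail-interval nfη lo up
  ... | _ , refl , nfη' , lo' , up' = ⟶₁*-tail (bachmann nfc L (λ ()) m nfη' lo' up')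
  bachmann {ω^ a · suc zero + 𝟎} (nfω nfa _ _ _) (limω _) _ m nfη lo up =
    bachmann-ω^ nfa (λ ()) m nfη lo up
  bachmann {ω^ a · suc (suc b) + 𝟎} (nfω nfa _ _ _) (limω _) _ m nfη lo up
    with coef-interval nfη lo up
  ... | _ , refl , nfη' , lo' , up' = ⟶₁*-tail (bachmann-ω^ nfa (λ ()) m nfη' lo' up')

  bachmann-ω^ : ∀ {e} → NF e → e ≢ 𝟎 → ∀ m {η} → NF η → ωfs e m ≤ₜ η → η <ₜ ω^ e → η ⟶₁* ωfs e m
  bachmann-ω^ nfe e≢𝟎 m nfη lo up with form nfe
  ... | isZero = ⊥-elim (e≢𝟎 refl)
  ... | isSucc j L _ rewrite ωfs-appendFin-suc L j m = ⟶₁*-ωmul L nfη lo up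
  ... | isLimit L rewrite ωfs-limit L m =
    ⟶₁*-ω^ nfη lo up (λ nfx lo' up' → bachmann nfe L (λ ()) m nfx lo' up')

⟶₁*-finite : ∀ {j β} → appendFin 𝟎 j ⟶₁* β → ∃[ i ] i ≤ j × β ≡ appendFin 𝟎 i
⟶₁*-finite {j} ε = j , ≤-refl , refl
⟶₁*-finite {suc j} (step ◅ p) with ⟶₁*-finite {j} (subst (_⟶₁* _) (fs-appendFin-suc lim𝟎 j) p)
... | i , i≤j , β≡i = i , m≤n⇒m≤1+n i≤j , β≡i

appendFin-finPart : ∀ {η} → NF η → limPart η ≡ 𝟎 → appendFin 𝟎 (finPart η) ≡ η
appendFin-finPart {η} nf η-fin =
  subst (λ l → appendFin l (finPart η) ≡ η) η-fin (appendFin-split nf)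

fs-1-predecessor : ∀ {η j} → NF η → finPart η ≡ suc j → fs η 1 ≡ appendFin (limPart η) j
fs-1-predecessor {η} {j} nf fp = begin
  fs η 1                                ≡⟨ cong (λ t → fs t 1) (appendFin-limPart nf fp) ⟨
  fs (appendFin (limPart η) (suc j)) 1  ≡⟨ fs-appendFin-suc (Lim₀-limPart η) j ⟩
  appendFin (limPart η) j               ∎
  where open ≡-Reasoning

⟶₁*-succₜ : ∀ {ζ η} → NF ζ → NF η → ¬ η <ₜ limPart ζ → η <ₜ ζ → ζ ⟶₁* succₜ η
⟶₁*-succₜ {ζ} {η} nfζ nfη η≮α η<ζ with finPart ζ | appendFin-split nfζ
... | zero | α≡ζ = ⊥-elim (η≮α (subst (η <ₜ_) (sym α≡ζ) η<ζ))
... | suc j | α+j+1≡ζ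
  with appendFin-interval (Lim₀-limPart ζ) nfη η≮α j (subst (η <ₜ_) (sym α+j+1≡ζ) η<ζ)
...   | i , i≤j , refl =
  subst₂ _⟶₁*_ α+j+1≡ζ (sym (succₜ-appendFin (Lim₀-limPart ζ) i))
         (appendFin-⟶₁* (Lim₀-limPart ζ) (s≤s i≤j))

mutual
  AG-unique : ∀ {k ξ r r'} → AG k ξ r → AG k ξ r' → r ≡ r'
  AG-unique (finite _) (finite _) = refl
  AG-unique (finite ξ-fin) (succCase ξ-inf _ _ _) = ⊥-elim (ξ-inf ξ-fin)
  AG-unique (finite ξ-fin) (limCase ξ-inf _ _) = ⊥-elim (ξ-inf ξ-fin)
  AG-unique (succCase ξ-inf _ _ _) (finite ξ-fin) = ⊥-elim (ξ-inf ξ-fin)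
  AG-unique (limCase ξ-inf _ _) (finite ξ-fin) = ⊥-elim (ξ-inf ξ-fin)
  AG-unique (succCase _ fp d it) (succCase _ fp' d' it')
    with suc-injective (trans (sym fp) fp')
  ... | refl = Iter-unique (AG-unique d d') it it'
  AG-unique (succCase _ fp _ _) (limCase _ fp' _) with trans (sym fp) fp'
  ... | ()
  AG-unique (limCase _ fp _) (succCase _ fp' _ _) with trans (sym fp) fp'
  ... | ()
  AG-unique (limCase _ _ it) (limCase _ _ it') = Iter-unique refl it it'

  Iter-unique : ∀ {k α i m m' r r'} → m ≡ m' → Iter k α i m r → Iter k α i m' r' → r ≡ r'
  Iter-unique refl done done = refl
  Iter-unique refl (step d it) (step d' it') = Iter-unique (AG-unique d d') it it'

AG-finite : ∀ {k} j → AG k (appendFin 𝟎 j) (suc j)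
AG-finite zero = finite refl
AG-finite (suc j) = finite refl

-- From here on 𝔸 is 𝔸_(k+1): the theorem assumes k ≥ 2, but k ≥ 1 suffices, since then every
-- iteration makes at least one step.

module _ (k : ℕ) where

  mutual
    mc-<-AG : ∀ {ξ r} → NF ξ → AG (suc k) ξ r → mc ξ < r
    mc-<-AG {𝟎} _ (finite _) = s≤s z≤n
    mc-<-AG {ω^ 𝟎 · b + c} (nfω _ _ nfc c<ω^𝟎) (finite _) with NF-<ₜω^𝟎⇒≡𝟎 nfc c<ω^𝟎
    ... | refl = ≤-refl
    mc-<-AG {ω^ (ω^ _ · _ + _) · b + c} _ (finite ())
    mc-<-AG {ξ} nf (succCase {b = j} α≢𝟎 fp d it) = begin-strict
      mc ξ                      ≡⟨ cong mc (appendFin-limPart nf fp) ⟨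
      mc (appendFin α (suc j))  ≤⟨ mc-appendFin-suc-≤ α j ⟩
      suc (mc (appendFin α j))  ≤⟨ mc-<-AG (NF-appendFin (NF-limPart nf) (Lim₀-limPart ξ) j) d ⟩
      _                         <⟨ Iter-< (NF-limPart nf) (Lim₀-limPart ξ) α≢𝟎 it ⟩
      _                         ∎
      where
      open ≤-Reasoning
      α : Tm
      α = limPart ξ
    mc-<-AG {ξ} nf (limCase α≢𝟎 _ it) = Iter-< (NF-limPart nf) (Lim₀-limPart ξ) α≢𝟎 it

    AG-fs-> : ∀ {α m r} → NF α → Lim₀ α → α ≢ 𝟎 → AG (suc k) (fs α m) r → m < r
    AG-fs-> {m = m} nfα L α≢𝟎 d = ≤-<-trans (mc-fs L nfα α≢𝟎 m) (mc-<-AG (NF-fs m nfα) d)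

    Iter-< : ∀ {α i m r} → NF α → Lim₀ α → α ≢ 𝟎 → Iter (suc k) α (suc i) m r → m < r
    Iter-< nfα L α≢𝟎 (step d it) = <-≤-trans (AG-fs-> nfα L α≢𝟎 d) (Iter-≤ nfα L α≢𝟎 it)

    Iter-≤ : ∀ {α i m r} → NF α → Lim₀ α → α ≢ 𝟎 → Iter (suc k) α i m r → m ≤ r
    Iter-≤ _ _ _ done = ≤-refl
    Iter-≤ nfα L α≢𝟎 (step d it) = <⇒≤ (Iter-< nfα L α≢𝟎 (step d it))

  AG≤ : Tm → ℕ → Set
  AG≤ β n = ∃[ n' ] n' ≤ n × AG (suc k) β n'

  AG≤-weaken : ∀ {β m n} → m ≤ n → AG≤ β m → AG≤ β n
  AG≤-weaken m≤n (n' , n'≤m , d) = n' , ≤-trans n'≤m m≤n , d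

  AG-⟶₁* : ∀ {η β n} → NF η → AG (suc k) η n → η ⟶₁* β → AG≤ β n
  AG-⟶₁* _ d ε = _ , ≤-refl , d
  AG-⟶₁* nf (finite η-fin) p with ⟶₁*-finite (subst (_⟶₁* _) (sym (appendFin-finPart nf η-fin)) p)
  ... | i , i≤j , refl = suc i , s≤s i≤j , AG-finite i
  AG-⟶₁* {η} nf (succCase {b = j} α≢𝟎 fp d it) (step ◅ p) =
    AG≤-weaken (Iter-≤ (NF-limPart nf) (Lim₀-limPart η) α≢𝟎 it)
      (AG-⟶₁* (NF-appendFin (NF-limPart nf) (Lim₀-limPart η) j) d
              (subst (_⟶₁* _) (fs-1-predecessor nf fp) p))
  AG-⟶₁* {η} nf (limCase α≢𝟎 fp (step d it)) (step ◅ p) =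
    AG≤-weaken (Iter-≤ nfα L α≢𝟎 it)
      (AG-⟶₁* (NF-fs _ nfα) d (α[mc]⟶₁*α[1] ◅◅ subst (λ t → fs t 1 ⟶₁* _) (sym α≡η) p))
    where
    nfα : NF (limPart η)
    nfα = NF-limPart nf
    L : Lim₀ (limPart η)
    L = Lim₀-limPart η
    α≡η : limPart η ≡ η
    α≡η = appendFin-limPart nf fp
    α[mc]⟶₁*α[1] : fs (limPart η) (mc η) ⟶₁* fs (limPart η) 1
    α[mc]⟶₁*α[1] = bachmann nfα L α≢𝟎 1 (NF-fs _ nfα) (fs-mono nfα (mc-pos nf)) (fs-<ₜ _ nfα α≢𝟎)

  AG-⟶₁*-≤ : ∀ {η β a b} → NF η → AG (suc k) η a → η ⟶₁* β → AG (suc k) β b → b ≤ a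
  AG-⟶₁*-≤ nf dη p dβ with AG-⟶₁* nf dη p
  ... | _ , n≤a , dβ' = subst (_≤ _) (AG-unique dβ' dβ) n≤a

  AG-succₜ-≤ : ∀ {ζ η b c} → NF ζ → NF η → ¬ η <ₜ limPart ζ → η <ₜ ζ →
               AG (suc k) ζ c → AG (suc k) (succₜ η) b → b ≤ c
  AG-succₜ-≤ nfζ nfη η≮α η<ζ dζ db = AG-⟶₁*-≤ nfζ dζ (⟶₁*-succₜ nfζ nfη η≮α η<ζ) db

  mutual
    AG-gap : ∀ {ζ η a b c} → NF ζ → NF η → η <ₜ ζ →
             AG (suc k) ζ c → AG (suc k) η a → AG (suc k) (succₜ η) b → a < c → b ≤ c
    AG-gap nfζ nfη η<ζ dζ@(finite ζ-fin) _ db _ =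
      AG-succₜ-≤ nfζ nfη (λ η<α → ≮ₜ𝟎 (subst (_ <ₜ_) ζ-fin η<α)) η<ζ dζ db
    AG-gap {ζ} {η} nfζ nfη η<ζ dζ@(succCase α≢𝟎 _ _ it) da db a<c with <ₜ-cmp η (limPart ζ)
    ... | tri< η<α _ _ = Iter-gap (NF-limPart nfζ) (Lim₀-limPart ζ) α≢𝟎 it nfη η<α da db a<c
    ... | tri≈ η≮α _ _ = AG-succₜ-≤ nfζ nfη η≮α η<ζ dζ db
    ... | tri> η≮α _ _ = AG-succₜ-≤ nfζ nfη η≮α η<ζ dζ db
    AG-gap {ζ} {η} nfζ nfη η<ζ (limCase α≢𝟎 fp it) da db a<c =
      Iter-gap (NF-limPart nfζ) (Lim₀-limPart ζ) α≢𝟎 it nfη η<α da db a<c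
      where
      η<α : η <ₜ limPart ζ
      η<α = subst (η <ₜ_) (sym (appendFin-limPart nfζ fp)) η<ζ

    Iter-gap : ∀ {α i m r η a b} → NF α → Lim₀ α → α ≢ 𝟎 → Iter (suc k) α (suc i) m r →
               NF η → η <ₜ α → AG (suc k) η a → AG (suc k) (succₜ η) b → a < r → b ≤ r
    Iter-gap nfα L α≢𝟎 (step _ it@(step _ _)) = Iter-gap nfα L α≢𝟎 it
    Iter-gap {α} {m = m} {η = η} nfα L α≢𝟎 (step d done) nfη η<α da db a<r
      with <ₜ-cmp η (fs α m)
    ... | tri< η<α[m] _ _ = AG-gap (NF-fs m nfα) nfη η<α[m] d da db a<r
    ... | tri≈ _ refl _ = ⊥-elim (<⇒≱ a<r (AG-⟶₁*-≤ nfη da ε d))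
    ... | tri> _ _ α[m]<η =
      ⊥-elim (<⇒≱ a<r (AG-⟶₁*-≤ nfη da (bachmann nfα L α≢𝟎 m nfη (inj₁ α[m]<η) η<α) d))

lemma4p7 : (k : ℕ) → 2 ≤ k → (ξ ζ : Tm) → NF ξ → NF ζ → ξ <ₜ ζ →
           (a b c : ℕ) → AG k ξ a → AG k (succₜ ξ) b → AG k ζ c →
           ¬ (a < c × c < b)
lemma4p7 (suc k) _ ξ ζ nfξ nfζ ξ<ζ a b c dξ dξ+1 dζ (a<c , c<b) =
  <⇒≱ c<b (AG-gap k nfζ nfξ ξ<ζ dζ dξ dξ+1 a<c)
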